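{- Let $n \geq 6$ be even and let $G_0=(V,E)$ be a graph on $n$ vertices. Suppose there are vertices $w,x,y,z \in V$ with $wx \in E$, $d_{G_0}(x)=1$ and $d_{G_0}(y)=d_{G_0}(z)=0$, such that $G_0\setminus\{x,y,z\}$ has a Hamilton cycle. If Max is the second player, then $s(G_0,\mathcal{PM}) \geq \binom{n-2}{2}$.
   Context: $\mathcal{PM}$ is the property of admitting a perfect matching. For a graph $H$ on $n$ vertices not in $\mathcal{PM}$, the saturation game $(H,\mathcal{PM})$ is played as follows. Starting with $G=H$, two players, Mini and Max, alternately add to $G$ an edge $e \notin E(G)$ such that $G\cup\{e\}$ has no perfect matching. The game ends when no such edge exists. Max wants to maximize and Mini to minimize the final number of edges. The score $s(H,\mathcal{PM})$ is the number of edges of the final graph under optimal play. $G_0\setminus S$ denotes the graph obtained by deleting the vertex set $S$. -}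

module Defs where

open import Data.Nat using (ℕ; zero; suc; _+_; _*_; _≤_; _<_)
open import Data.Fin using (Fin; toℕ; inject₁; fromℕ; _≟_)
open import Data.Fin.Properties using ()
open import Data.Bool using (Bool; true; false; _∨_; _∧_; if_then_else_)
open import Data.List using (List; map; allFin)
open import Data.Nat.ListAction using (sum)
open import Data.Product using (Σ; ∃; _×_; _,_)
open import Data.Sum using (_⊎_)
open import Relation.Nullary using (¬_)
open import Relation.Nullary.Decidable using (⌊_⌋)
open import Relation.Binary.PropositionalEquality using (_≡_; _≢_)
open import Function.Definitions using (Injective)
open import Data.Nat using (_<ᵇ_)

Graph : ℕ → Set
Graph n = Fin n → Fin n → Bool

IsSimple : ∀ {n} → Graph n → Set
IsSimple {n} G = (∀ (u v : Fin n) → G u v ≡ G v u) × (∀ (v : Fin n) → G v v ≡ false)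

deg : ∀ {n} → Graph n → Fin n → ℕ
deg {n} G v = sum (map (λ u → if G v u then 1 else 0) (allFin n))

numEdges : ∀ {n} → Graph n → ℕ
numEdges {n} G =
  sum (map (λ u → sum (map (λ v → if (toℕ u <ᵇ toℕ v) ∧ G u v then 1 else 0)
                             (allFin n)))
           (allFin n))

addEdge : ∀ {n} → Graph n → Fin n → Fin n → Graph n
addEdge G u v a b =
  G a b ∨ ((⌊ a ≟ u ⌋ ∧ ⌊ b ≟ v ⌋) ∨ (⌊ a ≟ v ⌋ ∧ ⌊ b ≟ u ⌋))

PerfectMatching : ∀ {n} → Graph n → Set
PerfectMatching {n} G =
  Σ (Fin n → Fin n) λ m →
    ∀ (v : Fin n) → (m (m v) ≡ v) × (m v ≢ v) × (G v (m v) ≡ true)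

HasPM : ∀ {n} → Graph n → Set
HasPM G = PerfectMatching G

LegalMove : ∀ {n} → Graph n → Fin n → Fin n → Set
LegalMove G u v = (u ≢ v) × (G u v ≡ false) × ¬ HasPM (addEdge G u v)

Terminal : ∀ {n} → Graph n → Set
Terminal {n} G = ∀ (u v : Fin n) → ¬ LegalMove G u v

data Player : Set where
  Mini Max : Player

other : Player → Player
other Mini = Max
other Max = Mini

Better : Player → ℕ → ℕ → Set
Better Mini s s' = s ≤ s'
Better Max  s s' = s' ≤ s

-- ScoreF k G p s : under optimal play from position G with p to move, the
-- final number of edges is s (minimax value).  The fuel k only bounds the
-- recursion depth; each move adds an edge, so fuel n*n is never exhausted.
ScoreF : ∀ {n} → ℕ → Graph n → Player → ℕ → Set
ScoreF zero G p s = Terminal G × (s ≡ numEdges G)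
ScoreF {n} (suc k) G p s =
  (Terminal G × (s ≡ numEdges G)) ⊎
  (Σ (Fin n) λ u → Σ (Fin n) λ v →
     LegalMove G u v × ScoreF k (addEdge G u v) (other p) s ×
     (∀ (u' v' : Fin n) (s' : ℕ) → LegalMove G u' v' →
        ScoreF k (addEdge G u' v') (other p) s' → Better p s s'))

Score : ∀ {n} → Graph n → Player → ℕ → Set
Score {n} G p s = ScoreF (n * n) G p s

HamiltonCycleOn : ∀ {n} → Graph n → (Fin n → Set) → Set
HamiltonCycleOn {n} G P =
  Σ ℕ λ m → Σ (Fin (suc m) → Fin n) λ f →
    (2 ≤ m) ×
    Injective _≡_ _≡_ f ×
    (∀ i → P (f i)) ×
    (∀ v → P v → ∃ λ i → f i ≡ v) ×
    (∀ (i : Fin m) → G (f (inject₁ i)) (f (Fin.suc i)) ≡ true) ×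
    (G (f (fromℕ m)) (f Fin.zero) ≡ true)

module Submission where

-- The Hamilton cycle C of G₀ ∖ {x, y, z} has n − 3 vertices, an odd number, so C minus any one of
-- its vertices has a perfect matching.  Hence in every PM-free supergraph of G₀, y and z are not
-- adjacent (take wx, yz and a matching of C − w), and, writing {Y, Z} = {y, z}, if xY is an edge then
-- no vertex c of C is adjacent to Z (take xY, cZ and a matching of C − c).  Mini's first move
-- therefore leaves some Z ∈ {y, z} isolated, and Max answers by playing xY, which is legal as Z stays
-- isolated.  From then on Z can only ever be joined to x, and once it is, the same holds for Y;
-- either way no edge avoiding Y and Z creates a perfect matching.  So the final graph contains all
-- (n − 2 choose 2) edges of the complete graph on the vertices other than Y and Z.

open import Data.Bool using (Bool; true; false; not; _∧_; _∨_; if_then_else_)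
import Data.Bool.Properties as Bool
open import Data.Bool.Properties using (∨-zeroʳ; ∨-identityʳ; ∨-comm; ∧-comm; ∧-identityʳ)
open import Data.Empty using (⊥; ⊥-elim)
open import Data.Fin as Fin
  using (Fin; toℕ; _≟_; fromℕ; fromℕ<; inject₁; finToFun; funToFin; remQuot; combine; splitAt; join)
open import Data.Fin.Patterns using (0F; 1F; 2F)
open import Data.Fin.Properties
  using ( any?; all?; toℕ-injective; toℕ≤pred[n]; toℕ-fromℕ; toℕ-fromℕ<; toℕ-inject₁
        ; finToFun-funToFin; remQuot-combine; splitAt-join; join-splitAt; cantor-schröder-bernstein )
open import Data.List using (map; allFin; tabulate)
open import Data.List.Properties using (map-tabulate)
open import Data.Nat as ℕ using (ℕ; zero; suc; _+_; _*_; _∸_; _≤_; _<_; z≤n; s≤s; _<ᵇ_; parity)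
import Data.Nat.ListAction as List
open import Data.Nat.Combinatorics using (_C_; nC1≡n; nCk+nC[k+1]≡[n+1]C[k+1])
open import Data.Nat.Divisibility using (_∣_; divides)
open import Data.Nat.Properties hiding (_≟_)
open import Algebra.Properties.Monoid.Sum +-0-monoid using (sum; sum-cong-≗; sum-replicate-zero)
open import Data.Parity as ℙ using (0ℙ; 1ℙ; _⁻¹)
open import Data.Parity.Properties
  using (⁻¹-selfInverse; ⁻¹-involutive; p≢p⁻¹; suc-homo-⁻¹)
  renaming (*-homo-* to ℙ*-homo-*; *-zeroʳ to ℙ*-zeroʳ)
open import Data.Product using (Σ; ∃; _×_; _,_; proj₁; proj₂; curry; uncurry)
open import Data.Sum using (_⊎_; inj₁; inj₂; map₁; [_,_]′)
open import Data.Sum.Properties using (inj₁-injective)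
open import Function using (_∘_; id; flip; case_of_)
open import Function.Definitions using (Injective; Surjective)
open import Relation.Binary using (tri<; tri≈; tri>)
open import Relation.Binary.PropositionalEquality
  using (_≡_; _≢_; _≗_; refl; sym; trans; cong; cong₂; subst; subst₂; module ≡-Reasoning)
open import Relation.Nullary using (¬_; Dec; yes; no; ¬?; _×-dec_; _⊎-dec_)
open import Relation.Nullary.Decidable using (map′; ⌊_⌋; dec-true; dec-false; isYes≗does; ⌊⌋-map′)

open import Defs

-- Finite sums

indicator : Bool → ℕ
indicator b = if b then 1 else 0

sum-allFin : ∀ {n} (f : Fin n → ℕ) → List.sum (map f (allFin n)) ≡ sum f
sum-allFin {n} f = trans (cong List.sum (map-tabulate id f)) (sum-tabulate f)
  where
  sum-tabulate : ∀ {k} (g : Fin k → ℕ) → List.sum (tabulate g) ≡ sum g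
  sum-tabulate {zero}  g = refl
  sum-tabulate {suc k} g = cong (g Fin.zero +_) (sum-tabulate (g ∘ Fin.suc))

sum-mono-≤ : ∀ {n} {f g : Fin n → ℕ} → (∀ i → f i ≤ g i) → sum f ≤ sum g
sum-mono-≤ {zero} f≤g = z≤n
sum-mono-≤ {suc n} f≤g = +-mono-≤ (f≤g Fin.zero) (sum-mono-≤ (f≤g ∘ Fin.suc))

sum-mono-< : ∀ {n} {f g : Fin n → ℕ} → (∀ i → f i ≤ g i) → ∀ j → f j < g j → sum f < sum g
sum-mono-< {suc n} f≤g Fin.zero    fj<gj = +-mono-<-≤ fj<gj (sum-mono-≤ (f≤g ∘ Fin.suc))
sum-mono-< {suc n} f≤g (Fin.suc j) fj<gj = +-mono-≤-< (f≤g Fin.zero) (sum-mono-< (f≤g ∘ Fin.suc) j fj<gj)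

sum≡0⇒≡0 : ∀ {n} (f : Fin n → ℕ) → sum f ≡ 0 → ∀ i → f i ≡ 0
sum≡0⇒≡0 {suc n} f Σf≡0 Fin.zero    = m+n≡0⇒m≡0 (f Fin.zero) Σf≡0
sum≡0⇒≡0 {suc n} f Σf≡0 (Fin.suc i) = sum≡0⇒≡0 (f ∘ Fin.suc) (m+n≡0⇒n≡0 (f Fin.zero) Σf≡0) i

sum-≤-* : ∀ {n} {f : Fin n → ℕ} c → (∀ i → f i ≤ c) → sum f ≤ n * c
sum-≤-* {zero} c f≤c = z≤n
sum-≤-* {suc n} c f≤c = +-mono-≤ (f≤c Fin.zero) (sum-≤-* c (f≤c ∘ Fin.suc))

-- Adding an edge

edge-sym : ∀ {n} {G : Graph n} → IsSimple G → ∀ {u v} → G u v ≡ true → G v u ≡ true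
edge-sym (sym-G , _) {u} {v} uv = trans (sym-G v u) uv

⌊≟⌋-refl : ∀ {n} (a : Fin n) → ⌊ a ≟ a ⌋ ≡ true
⌊≟⌋-refl a = trans (isYes≗does (a ≟ a)) (dec-true (a ≟ a) refl)

⌊≟⌋-≢ : ∀ {n} {a b : Fin n} → a ≢ b → ⌊ a ≟ b ⌋ ≡ false
⌊≟⌋-≢ {a = a} {b} a≢b = trans (isYes≗does (a ≟ b)) (dec-false (a ≟ b) a≢b)

addEdge-adds : ∀ {n} (G : Graph n) u v → addEdge G u v u v ≡ true
addEdge-adds G u v rewrite ⌊≟⌋-refl u | ⌊≟⌋-refl v = ∨-zeroʳ (G u v)

addEdge-keeps : ∀ {n} (G : Graph n) u v {a b} → G a b ≡ true → addEdge G u v a b ≡ true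
addEdge-keeps G u v ab rewrite ab = refl

addEdge-away : ∀ {n} (G : Graph n) {u v a} → a ≢ u → a ≢ v → ∀ b → addEdge G u v a b ≡ G a b
addEdge-away G {u} {v} {a} a≢u a≢v b
  rewrite ⌊≟⌋-≢ a≢u | ⌊≟⌋-≢ a≢v = ∨-identityʳ (G a b)

addEdge-simple : ∀ {n} {G : Graph n} {u v} → u ≢ v → IsSimple G → IsSimple (addEdge G u v)
addEdge-simple {G = G} {u} {v} u≢v (sym-G , irrefl-G) = symmetric , irreflexive
  where
  symmetric : ∀ a b → addEdge G u v a b ≡ addEdge G u v b a
  symmetric a b rewrite sym-G a b =
    cong (G b a ∨_) (trans (∨-comm (⌊ a ≟ u ⌋ ∧ ⌊ b ≟ v ⌋) _)
                           (cong₂ _∨_ (∧-comm ⌊ a ≟ v ⌋ _) (∧-comm ⌊ a ≟ u ⌋ _)))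
  irreflexive : ∀ a → addEdge G u v a a ≡ false
  irreflexive a rewrite irrefl-G a with a ≟ u | a ≟ v
  ... | yes refl | yes refl = ⊥-elim (u≢v refl)
  ... | yes _    | no _     = refl
  ... | no _     | yes _    = refl
  ... | no _     | no _     = refl

isolated-addEdge : ∀ {n} (G : Graph n) {u v a} → a ≢ u → a ≢ v →
  (∀ t → G a t ≡ false) → ∀ t → addEdge G u v a t ≡ false
isolated-addEdge G a≢u a≢v a-isolated t = trans (addEdge-away G a≢u a≢v t) (a-isolated t)

sole-neighbour-addEdge : ∀ {n} (G : Graph n) {u v a x} → a ≢ u → a ≢ v →
  (∀ t → G a t ≡ true → t ≡ x) → ∀ t → addEdge G u v a t ≡ true → t ≡ x
sole-neighbour-addEdge G a≢u a≢v a-sole t at = a-sole t (trans (sym (addEdge-away G a≢u a≢v t)) at)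

deg≡0⇒isolated : ∀ {n} (G : Graph n) {v} → deg G v ≡ 0 → ∀ u → G v u ≡ false
deg≡0⇒isolated G {v} deg≡0 u
  with G v u | sum≡0⇒≡0 (λ u → indicator (G v u)) (trans (sym (sum-allFin (λ u → indicator (G v u)))) deg≡0) u
... | false | _ = refl
... | true  | ()

nonEdges : ∀ {n} → Graph n → ℕ
nonEdges G = sum λ a → sum λ b → indicator (not (G a b))

nonEdges≤n*n : ∀ {n} (G : Graph n) → nonEdges G ≤ n * n
nonEdges≤n*n {n} G = sum-≤-* n λ a →
  ≤-trans (sum-≤-* 1 λ b → indicator≤1 (not (G a b))) (≤-reflexive (*-identityʳ n))
  where
  indicator≤1 : ∀ b → indicator b ≤ 1
  indicator≤1 false = z≤n
  indicator≤1 true  = s≤s z≤n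

nonEdges-addEdge-< : ∀ {n} (G : Graph n) {u v} → G u v ≡ false → nonEdges (addEdge G u v) < nonEdges G
nonEdges-addEdge-< G {u} {v} uv≡false =
  sum-mono-< (λ a → sum-mono-≤ λ b → ∨-antitone (G a b) _) u
    (sum-mono-< (λ b → ∨-antitone (G u b) _) v uv-dropped)
  where
  ∨-antitone : ∀ b c → indicator (not (b ∨ c)) ≤ indicator (not b)
  ∨-antitone true  c     = z≤n
  ∨-antitone false true  = z≤n
  ∨-antitone false false = s≤s z≤n
  uv-dropped : indicator (not (addEdge G u v u v)) < indicator (not (G u v))
  uv-dropped rewrite addEdge-adds G u v | uv≡false = s≤s z≤n

-- Perfect matchings

IsPerfectMatching : ∀ {n} → Graph n → (Fin n → Fin n) → Set
IsPerfectMatching G M = ∀ v → (M (M v) ≡ v) × (M v ≢ v) × (G v (M v) ≡ true)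

isolated⇒¬HasPM : ∀ {n} (H : Graph n) {z} → (∀ t → H z t ≡ false) → ¬ HasPM H
isolated⇒¬HasPM H {z} z-isolated (M , M-perfect)
  with () ← trans (sym (proj₂ (proj₂ (M-perfect z)))) (z-isolated (M z))

sole-common-neighbour⇒¬HasPM : ∀ {n} (H : Graph n) {x y z} → y ≢ z →
  (∀ t → H y t ≡ true → t ≡ x) → (∀ t → H z t ≡ true → t ≡ x) → ¬ HasPM H
sole-common-neighbour⇒¬HasPM H {x} {y} {z} y≢z y-sole z-sole (M , M-perfect) = y≢z (begin
  y         ≡⟨ sym (proj₁ (M-perfect y)) ⟩
  M (M y)   ≡⟨ cong M (trans (y-sole (M y) (edge y)) (sym (z-sole (M z) (edge z)))) ⟩
  M (M z)   ≡⟨ proj₁ (M-perfect z) ⟩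
  z         ∎)
  where
  open ≡-Reasoning
  edge : ∀ v → H v (M v) ≡ true
  edge v = proj₂ (proj₂ (M-perfect v))

isPerfectMatching? : ∀ {n} (G : Graph n) M → Dec (IsPerfectMatching G M)
isPerfectMatching? G M =
  all? λ v → M (M v) ≟ v ×-dec ¬? (M v ≟ v) ×-dec G v (M v) Bool.≟ true

isPerfectMatching-cong : ∀ {n} (G : Graph n) {M M′} → M ≗ M′ →
  IsPerfectMatching G M → IsPerfectMatching G M′
isPerfectMatching-cong G {M} {M′} M≗M′ M-perfect v with M-perfect v
... | involutive , fixpoint-free , edge =
  trans (sym (trans (cong M (M≗M′ v)) (M≗M′ (M′ v)))) involutive ,
  (λ M′v≡v → fixpoint-free (trans (M≗M′ v) M′v≡v)) ,
  subst (λ t → G v t ≡ true) (M≗M′ v) edge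

hasPM? : ∀ {n} (G : Graph n) → Dec (HasPM G)
hasPM? {n} G = map′
  (λ (k , k-perfect) → finToFun k , k-perfect)
  (λ (M , M-perfect) → funToFin M , isPerfectMatching-cong G (sym ∘ finToFun-funToFin M) M-perfect)
  (any? λ k → isPerfectMatching? G (finToFun {n} {n} k))

perfectMatching-transport : ∀ {A : Set} {n} (G : Graph n) (label : A → Fin n) →
  Injective _≡_ _≡_ label → Surjective _≡_ _≡_ label →
  (μ : A → A) → (∀ a → μ (μ a) ≡ a) → (∀ a → μ a ≢ a) → (∀ a → G (label a) (label (μ a)) ≡ true) →
  HasPM G
perfectMatching-transport G label label-injective label-surjective μ μ-involutive μ-fixpoint-free μ-edge =
  M , λ v → M-involutive v , M-fixpoint-free v , M-edge v
  where
  index : Fin _ → _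
  index v = proj₁ (label-surjective v)
  label-index : ∀ v → label (index v) ≡ v
  label-index v = proj₂ (label-surjective v) refl
  index-label : ∀ a → index (label a) ≡ a
  index-label a = label-injective (label-index (label a))
  M : Fin _ → Fin _
  M v = label (μ (index v))
  M-involutive : ∀ v → M (M v) ≡ v
  M-involutive v = trans (cong (label ∘ μ) (index-label (μ (index v))))
                         (trans (cong label (μ-involutive (index v))) (label-index v))
  M-fixpoint-free : ∀ v → M v ≢ v
  M-fixpoint-free v Mv≡v = μ-fixpoint-free (index v) (label-injective (trans Mv≡v (sym (label-index v))))
  M-edge : ∀ v → G v (M v) ≡ true
  M-edge v = subst (λ u → G u (M v) ≡ true) (label-index v) (μ-edge (index v))

-- The value of the saturation game

Better-refl : ∀ p {s} → Better p s s
Better-refl Mini = ≤-refl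
Better-refl Max  = ≤-refl

Better-trans : ∀ p {s s′ s″} → Better p s s′ → Better p s′ s″ → Better p s s″
Better-trans Mini = ≤-trans
Better-trans Max  = flip ≤-trans

Better-total : ∀ p s s′ → Better p s s′ ⊎ Better p s′ s
Better-total Mini s s′ = ≤-total s s′
Better-total Max  s s′ = ≤-total s′ s

Better-antisym : ∀ p {s s′} → Better p s s′ → Better p s′ s → s ≡ s′
Better-antisym Mini = ≤-antisym
Better-antisym Max  = flip ≤-antisym

Optimum : Player → {A : Set} → (A → Set) → (A → ℕ) → Set
Optimum p {A} L c = Σ A λ a → L a × (∀ a′ → L a′ → Better p (c a) (c a′))

optimum-Fin : ∀ p {k} (L : Fin k → Set) → (∀ i → Dec (L i)) → (c : Fin k → ℕ) →
  (∀ i → ¬ L i) ⊎ Optimum p L c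
optimum-Fin p {zero} L L? c = inj₁ λ ()
optimum-Fin p {suc k} L L? c with optimum-Fin p (L ∘ Fin.suc) (L? ∘ Fin.suc) (c ∘ Fin.suc) | L? Fin.zero
... | inj₁ none | no ¬l₀ = inj₁ λ { Fin.zero → ¬l₀ ; (Fin.suc i) → none i }
... | inj₁ none | yes l₀ =
  inj₂ (Fin.zero , l₀ , λ { Fin.zero _ → Better-refl p ; (Fin.suc j) l → ⊥-elim (none j l) })
... | inj₂ (i , l , best) | no ¬l₀ =
  inj₂ (Fin.suc i , l , λ { Fin.zero l₀ → ⊥-elim (¬l₀ l₀) ; (Fin.suc j) → best j })
... | inj₂ (i , l , best) | yes l₀ with Better-total p (c Fin.zero) (c (Fin.suc i))
...   | inj₁ c₀-better = inj₂ (Fin.zero , l₀ ,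
          λ { Fin.zero _ → Better-refl p ; (Fin.suc j) lⱼ → Better-trans p c₀-better (best j lⱼ) })
...   | inj₂ cᵢ-better = inj₂ (Fin.suc i , l , λ { Fin.zero _ → cᵢ-better ; (Fin.suc j) → best j })

optimum-surjection : ∀ p {k} {A : Set} (e : Fin k → A) → (∀ a → ∃ λ i → e i ≡ a) →
  (L : A → Set) → (∀ a → Dec (L a)) → (c : A → ℕ) → (∀ a → ¬ L a) ⊎ Optimum p L c
optimum-surjection p e e-surjective L L? c with optimum-Fin p (L ∘ e) (L? ∘ e) (c ∘ e)
... | inj₁ none = inj₁ λ a → case e-surjective a of λ where (i , refl) → none i
... | inj₂ (i , l , best) =
  inj₂ (e i , l , λ a → case e-surjective a of λ where (j , refl) → best j)

legalMove? : ∀ {n} (G : Graph n) u v → Dec (LegalMove G u v)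
legalMove? G u v = ¬? (u ≟ v) ×-dec G u v Bool.≟ false ×-dec ¬? (hasPM? (addEdge G u v))

legalMove-nonEdges : ∀ {n k} {G : Graph n} {u v} → LegalMove G u v →
  nonEdges G ≤ suc k → nonEdges (addEdge G u v) ≤ k
legalMove-nonEdges {G = G} (_ , uv≡false , _) bound =
  ≤-pred (≤-trans (nonEdges-addEdge-< G uv≡false) bound)

optimalMove : ∀ {n} (c : Graph n → ℕ) (G : Graph n) p →
  Terminal G ⊎ Optimum p (uncurry (LegalMove G)) (λ (u , v) → c (addEdge G u v))
optimalMove {n} c G p =
  map₁ curry (optimum-surjection p (remQuot n) pairs-surjective _ (uncurry (legalMove? G)) _)
  where
  pairs-surjective : ∀ uv → ∃ λ i → remQuot n i ≡ uv
  pairs-surjective (u , v) = combine u v , remQuot-combine u v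

value : ∀ {n} → ℕ → Graph n → Player → ℕ
value zero    G p = numEdges G
value (suc k) G p with optimalMove (λ H → value k H (other p)) G p
... | inj₁ _                 = numEdges G
... | inj₂ ((u , v) , _ , _) = value k (addEdge G u v) (other p)

ScoreF-unique : ∀ k {n} {G : Graph n} {p s s′} → ScoreF k G p s → ScoreF k G p s′ → s ≡ s′
ScoreF-unique zero    (_ , s≡) (_ , s′≡) = trans s≡ (sym s′≡)
ScoreF-unique (suc k) (inj₁ (_ , s≡)) (inj₁ (_ , s′≡)) = trans s≡ (sym s′≡)
ScoreF-unique (suc k) (inj₁ (terminal , _)) (inj₂ (u , v , legal , _)) = ⊥-elim (terminal u v legal)
ScoreF-unique (suc k) (inj₂ (u , v , legal , _)) (inj₁ (terminal , _)) = ⊥-elim (terminal u v legal)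
ScoreF-unique (suc k) {p = p} (inj₂ (u , v , legal , score , best))
                              (inj₂ (u′ , v′ , legal′ , score′ , best′)) =
  Better-antisym p (best u′ v′ _ legal′ score′) (best′ u v _ legal score)

value-isScore : ∀ k {n} (G : Graph n) p → nonEdges G ≤ k → ScoreF k G p (value k G p)
value-isScore zero G p bound =
  (λ u v legal → n≮0 (<-≤-trans (nonEdges-addEdge-< G (proj₁ (proj₂ legal))) bound)) , refl
value-isScore (suc k) G p bound with optimalMove (λ H → value k H (other p)) G p
... | inj₁ terminal = inj₁ (terminal , refl)
... | inj₂ ((u , v) , legal , best) =
  inj₂ (u , v , legal , value-isScore k _ _ (legalMove-nonEdges legal bound) ,
        λ u′ v′ s′ legal′ score′ →
          subst (Better p _) (ScoreF-unique k (value-isScore k _ _ (legalMove-nonEdges legal′ bound)) score′)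
                (best (u′ , v′) legal′))

ScoreF-Better-move : ∀ k {n} {G : Graph n} {p u v s} → LegalMove G u v → nonEdges G ≤ suc k →
  ScoreF (suc k) G p s → Better p s (value k (addEdge G u v) (other p))
ScoreF-Better-move k legal bound (inj₁ (terminal , _)) = ⊥-elim (terminal _ _ legal)
ScoreF-Better-move k legal bound (inj₂ (_ , _ , _ , _ , best)) =
  best _ _ _ legal (value-isScore k _ _ (legalMove-nonEdges legal bound))

ScoreF-attained : ∀ k {n} {G : Graph n} {p s} (Q : Graph n → Set) →
  (∀ {H u v} → Q H → LegalMove H u v → Q (addEdge H u v)) → Q G → ScoreF k G p s →
  ∃ λ H → Q H × Terminal H × s ≡ numEdges H
ScoreF-attained zero    {G = G} Q Q-step QG (terminal , s≡) = G , QG , terminal , s≡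
ScoreF-attained (suc k) {G = G} Q Q-step QG (inj₁ (terminal , s≡)) = G , QG , terminal , s≡
ScoreF-attained (suc k) Q Q-step QG (inj₂ (u , v , legal , score , _)) =
  ScoreF-attained k Q Q-step (Q-step QG legal) score

-- Counting edges

size : ∀ {n} → (Fin n → Bool) → ℕ
size A = sum (indicator ∘ A)

pairsWithin : ∀ {n} → (Fin n → Bool) → ℕ
pairsWithin A = sum λ u → sum λ v → indicator ((toℕ u <ᵇ toℕ v) ∧ (A u ∧ A v))

pairsWithin≡size-C-2 : ∀ {n} (A : Fin n → Bool) → pairsWithin A ≡ size A C 2
pairsWithin≡size-C-2 {zero} A = refl
-- The pairs containing vertex 0 form the first row; the other rows are pairsWithin (A ∘ suc) on the nose.
pairsWithin≡size-C-2 {suc n} A = begin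
  sum (λ v → indicator (A Fin.zero ∧ A (Fin.suc v))) + pairsWithin (A ∘ Fin.suc)
    ≡⟨ cong₂ _+_ (first-row (A Fin.zero)) (pairsWithin≡size-C-2 (A ∘ Fin.suc)) ⟩
  indicator (A Fin.zero) * size (A ∘ Fin.suc) + size (A ∘ Fin.suc) C 2
    ≡⟨ pascal (A Fin.zero) (size (A ∘ Fin.suc)) ⟩
  (indicator (A Fin.zero) + size (A ∘ Fin.suc)) C 2 ∎
  where
  open ≡-Reasoning
  first-row : ∀ a → sum (λ v → indicator (a ∧ A (Fin.suc v))) ≡ indicator a * size (A ∘ Fin.suc)
  first-row true  = sym (+-identityʳ _)
  first-row false = sum-replicate-zero n
  pascal : ∀ a k → indicator a * k + k C 2 ≡ (indicator a + k) C 2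
  pascal true  k =
    trans (cong (_+ k C 2) (trans (+-identityʳ k) (sym (nC1≡n k)))) (nCk+nC[k+1]≡[n+1]C[k+1] k 1)
  pascal false k = refl

numEdges-sum : ∀ {n} (G : Graph n) → numEdges G ≡ sum λ u → sum λ v → indicator ((toℕ u <ᵇ toℕ v) ∧ G u v)
numEdges-sum {n} G =
  trans (sum-allFin (λ u → List.sum (map (edgeAbove u) (allFin n))))
        (sum-cong-≗ λ u → sum-allFin (edgeAbove u))
  where
  edgeAbove : Fin n → Fin n → ℕ
  edgeAbove u v = indicator ((toℕ u <ᵇ toℕ v) ∧ G u v)

pairsWithin≤numEdges : ∀ {n} (G : Graph n) (A : Fin n → Bool) →
  (∀ u v → u ≢ v → A u ≡ true → A v ≡ true → G u v ≡ true) → pairsWithin A ≤ numEdges G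
pairsWithin≤numEdges G A clique =
  subst (pairsWithin A ≤_) (sym (numEdges-sum G)) (sum-mono-≤ λ u → sum-mono-≤ λ v → pair≤edge u v)
  where
  <ᵇ-irrefl : ∀ {k} → (k <ᵇ k) ≡ true → ⊥
  <ᵇ-irrefl {suc k} = <ᵇ-irrefl {k}
  pair≤edge : ∀ u v → indicator ((toℕ u <ᵇ toℕ v) ∧ (A u ∧ A v)) ≤ indicator ((toℕ u <ᵇ toℕ v) ∧ G u v)
  pair≤edge u v with toℕ u <ᵇ toℕ v in u<v | A u in Au | A v in Av
  ... | false | _     | _     = z≤n
  ... | true  | false | _     = z≤n
  ... | true  | true  | false = z≤n
  ... | true  | true  | true  rewrite clique u v (λ { refl → <ᵇ-irrefl {toℕ u} u<v }) Au Av = ≤-refl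

⌊suc≟suc⌋ : ∀ {n} (a b : Fin n) → ⌊ Fin.suc a ≟ Fin.suc b ⌋ ≡ ⌊ a ≟ b ⌋
⌊suc≟suc⌋ a b = ⌊⌋-map′ _ _ (a ≟ b)

size-≢ : ∀ {n} (y : Fin n) → 1 + size (λ v → not ⌊ v ≟ y ⌋) ≡ n
size-≢ {suc n} Fin.zero    = cong suc (size-true n)
  where
  size-true : ∀ k → size {k} (λ _ → true) ≡ k
  size-true zero    = refl
  size-true (suc k) = cong suc (size-true k)
size-≢ {suc n} (Fin.suc y) =
  cong suc (trans (cong suc (sum-cong-≗ λ v → cong (indicator ∘ not) (⌊suc≟suc⌋ v y))) (size-≢ y))

size-≢₂ : ∀ {n} {y z : Fin n} → y ≢ z → 2 + size (λ v → not ⌊ v ≟ y ⌋ ∧ not ⌊ v ≟ z ⌋) ≡ n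
size-≢₂ {suc n} {Fin.zero}  {Fin.zero}  y≢z = ⊥-elim (y≢z refl)
size-≢₂ {suc n} {Fin.zero}  {Fin.suc z} y≢z =
  cong suc (trans (cong suc (sum-cong-≗ λ v → cong (indicator ∘ not) (⌊suc≟suc⌋ v z))) (size-≢ z))
size-≢₂ {suc n} {Fin.suc y} {Fin.zero}  y≢z =
  cong suc (trans (cong suc (sum-cong-≗ λ v →
    trans (cong indicator (∧-identityʳ _)) (cong (indicator ∘ not) (⌊suc≟suc⌋ v y)))) (size-≢ y))
size-≢₂ {suc n} {Fin.suc y} {Fin.suc z} y≢z =
  cong suc (trans (cong (2 +_) (sum-cong-≗ λ v →
    cong₂ (λ p q → indicator (not p ∧ not q)) (⌊suc≟suc⌋ v y) (⌊suc≟suc⌋ v z)))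
    (size-≢₂ (y≢z ∘ cong Fin.suc)))

clique-avoiding-two⇒numEdges : ∀ {n} (G : Graph n) {y z} → y ≢ z →
  (∀ u v → u ≢ v → u ≢ y → u ≢ z → v ≢ y → v ≢ z → G u v ≡ true) → (n ∸ 2) C 2 ≤ numEdges G
clique-avoiding-two⇒numEdges {n} G {y} {z} y≢z clique =
  subst (λ k → k C 2 ≤ numEdges G) size-A
    (subst (_≤ numEdges G) (pairsWithin≡size-C-2 A) (pairsWithin≤numEdges G A clique-A))
  where
  A : Fin n → Bool
  A v = not ⌊ v ≟ y ⌋ ∧ not ⌊ v ≟ z ⌋
  size-A : size A ≡ n ∸ 2
  size-A = trans (sym (m+n∸m≡n 2 (size A))) (cong (_∸ 2) (size-≢₂ y≢z))
  ≢-of-A : ∀ {u y} → not ⌊ u ≟ y ⌋ ≡ true → u ≢ y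
  ≢-of-A {u} {y} u≢y refl rewrite ⌊≟⌋-refl u with () ← u≢y
  ∧-true : ∀ {a b} → a ∧ b ≡ true → (a ≡ true) × (b ≡ true)
  ∧-true {true} {true} _ = refl , refl
  clique-A : ∀ u v → u ≢ v → A u ≡ true → A v ≡ true → G u v ≡ true
  clique-A u v u≢v Au Av with ∧-true {not ⌊ u ≟ y ⌋} Au | ∧-true {not ⌊ v ≟ y ⌋} Av
  ... | u≢y , u≢z | v≢y , v≢z = clique u v u≢v (≢-of-A u≢y) (≢-of-A u≢z) (≢-of-A v≢y) (≢-of-A v≢z)

-- Perfect matchings of an odd cycle minus a vertex

parity-suc : ∀ n → parity (suc n) ≡ parity n ⁻¹
parity-suc n = sym (⁻¹-selfInverse (suc-homo-⁻¹ n))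

⁻¹-≢⇒≡ : ∀ {p q} → p ⁻¹ ≢ q → p ≡ q
⁻¹-≢⇒≡ {0ℙ} {0ℙ} _ = refl
⁻¹-≢⇒≡ {0ℙ} {1ℙ} ≢ = ⊥-elim (≢ refl)
⁻¹-≢⇒≡ {1ℙ} {0ℙ} ≢ = ⊥-elim (≢ refl)
⁻¹-≢⇒≡ {1ℙ} {1ℙ} _ = refl

≢⇒⁻¹-≡ : ∀ {p q} → p ≢ q → p ⁻¹ ≡ q
≢⇒⁻¹-≡ {p} p≢q = ⁻¹-≢⇒≡ (λ p⁻¹⁻¹≡q → p≢q (trans (sym (⁻¹-involutive p)) p⁻¹⁻¹≡q))

parity-even : ∀ {n} → 2 ∣ n → parity n ≡ 0ℙ
parity-even (divides q refl) = trans (ℙ*-homo-* q 2) (ℙ*-zeroʳ (parity q))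

-- The cyclic order on 0, 1, …, m; next and prev are only meaningful on arguments ≤ m.
module CyclicOrder (m : ℕ) where

  next : ℕ → ℕ
  next j with j ℕ.≟ m
  ... | yes _ = 0
  ... | no _  = suc j

  prev : ℕ → ℕ
  prev zero    = m
  prev (suc j) = j

  next-m : next m ≡ 0
  next-m with m ℕ.≟ m
  ... | yes _  = refl
  ... | no m≢m = ⊥-elim (m≢m refl)

  next-< : ∀ {j} → j < m → next j ≡ suc j
  next-< {j} j<m with j ℕ.≟ m
  ... | yes refl = ⊥-elim (<-irrefl refl j<m)
  ... | no _     = refl

  next-≤ : ∀ {j} → j ≤ m → next j ≤ m
  next-≤ {j} j≤m with j ℕ.≟ m
  ... | yes _   = z≤n
  ... | no j≢m  = ≤∧≢⇒< j≤m j≢m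

  prev-≤ : ∀ {j} → j ≤ m → prev j ≤ m
  prev-≤ {zero}  _   = ≤-refl
  prev-≤ {suc j} j≤m = ≤-trans (n≤1+n j) j≤m

  next-prev : ∀ {j} → j ≤ m → next (prev j) ≡ j
  next-prev {zero}  _   = next-m
  next-prev {suc j} j≤m = next-< j≤m

  next-≢ : 0 < m → ∀ j → next j ≢ j
  next-≢ 0<m j with j ℕ.≟ m
  ... | yes refl = λ 0≡m → <-irrefl 0≡m 0<m
  ... | no _     = λ ()

  prev-≢ : 0 < m → ∀ j → prev j ≢ j
  prev-≢ 0<m zero    m≡0 = <-irrefl (sym m≡0) 0<m
  prev-≢ 0<m (suc j) ()

  prev-next : ∀ {j} → j ≤ m → prev (next j) ≡ j
  prev-next {j} j≤m with j ℕ.≟ m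
  ... | yes j≡m = sym j≡m
  ... | no _    = refl

  CyclicallyAdjacent : ℕ → ℕ → Set
  CyclicallyAdjacent j k = next j ≡ k ⊎ next k ≡ j

module OddCycleMatching (m : ℕ) (m-even : parity m ≡ 0ℙ) (i : ℕ) (i≤m : i ≤ m) where

  open CyclicOrder m

  -- Deleting i from the odd cycle leaves a path of even length, cut into consecutive pairs; j is
  -- paired with its successor exactly when Forward j.
  Forward : ℕ → Set
  Forward j = (j < i × parity j ≡ parity i) ⊎ (i < j × parity j ≢ parity i)

  forward? : ∀ j → Dec (Forward j)
  forward? j = (j <? i ×-dec parity j ℙ.≟ parity i) ⊎-dec (i <? j ×-dec ¬? (parity j ℙ.≟ parity i))

  partner : ℕ → ℕ
  partner j with forward? j
  ... | yes _ = next j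
  ... | no _  = prev j

  parity-suc-≢ : ∀ j → parity j ≡ parity i → parity (suc j) ≢ parity i
  parity-suc-≢ j pj≡pi psj≡pi =
    p≢p⁻¹ (parity i) (trans (sym psj≡pi) (trans (parity-suc j) (cong _⁻¹ pj≡pi)))

  forward-next : ∀ {j} → j ≤ m → Forward j → next j ≢ i × ¬ Forward (next j)
  forward-next {j} j≤m (inj₁ (j<i , pj≡pi)) rewrite next-< (<-≤-trans j<i i≤m) =
    (λ { refl → parity-suc-≢ j pj≡pi refl }) ,
    λ { (inj₁ (_ , psj≡pi)) → parity-suc-≢ j pj≡pi psj≡pi
      ; (inj₂ (i<sj , _))   → <⇒≱ j<i (≤-pred i<sj) }
  forward-next {j} j≤m (inj₂ (i<j , pj≢pi)) with j ℕ.≟ m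
  ... | yes refl =
    (λ { refl → pj≢pi m-even }) ,
    λ { (inj₁ (_ , p0≡pi)) → pj≢pi (trans m-even p0≡pi)
      ; (inj₂ (i<0 , _))   → n≮0 i<0 }
  ... | no j≢m =
    (λ { refl → <-asym i<j (n<1+n j) }) ,
    λ { (inj₁ (sj<i , _))   → <-asym i<j (<-trans (n<1+n j) sj<i)
      ; (inj₂ (_ , psj≢pi)) → psj≢pi (trans (parity-suc j) (≢⇒⁻¹-≡ pj≢pi)) }

  backward-prev : ∀ {j} → j ≤ m → j ≢ i → ¬ Forward j → prev j ≢ i × Forward (prev j)
  backward-prev {j} j≤m j≢i backward with <-cmp j i | parity j ℙ.≟ parity i
  ... | tri≈ _ j≡i _ | _ = ⊥-elim (j≢i j≡i)
  ... | tri< j<i _ _ | yes pj≡pi = ⊥-elim (backward (inj₁ (j<i , pj≡pi)))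
  ... | tri> _ _ i<j | no pj≢pi  = ⊥-elim (backward (inj₂ (i<j , pj≢pi)))
  backward-prev {zero} j≤m j≢i backward | tri< 0<i _ _ | no p0≢pi =
    (λ m≡i → p0≢pi (trans (sym m-even) (cong parity m≡i))) ,
    inj₂ (≤∧≢⇒< i≤m (λ i≡m → p0≢pi (trans (sym m-even) (cong parity (sym i≡m)))) ,
          λ pm≡pi → p0≢pi (trans (sym m-even) pm≡pi))
  backward-prev {suc k} j≤m j≢i backward | tri< sk<i _ _ | no psk≢pi =
    (λ k≡i → <-irrefl k≡i (<-trans (n<1+n k) sk<i)) ,
    inj₁ (<-trans (n<1+n k) sk<i , ⁻¹-≢⇒≡ (subst (_≢ parity i) (parity-suc k) psk≢pi))
  backward-prev {suc k} j≤m j≢i backward | tri> _ _ i<sk | yes psk≡pi =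
    (λ k≡i → pk≢pi (cong parity k≡i)) ,
    inj₂ (≤∧≢⇒< (≤-pred i<sk) (λ i≡k → pk≢pi (cong parity (sym i≡k))) , pk≢pi)
    where
    pk≢pi : parity k ≢ parity i
    pk≢pi pk≡pi = parity-suc-≢ k pk≡pi psk≡pi

  partner-forward : ∀ {j} → Forward j → partner j ≡ next j
  partner-forward {j} fwd with forward? j
  ... | yes _   = refl
  ... | no ¬fwd = ⊥-elim (¬fwd fwd)

  partner-backward : ∀ {j} → ¬ Forward j → partner j ≡ prev j
  partner-backward {j} ¬fwd with forward? j
  ... | yes fwd = ⊥-elim (¬fwd fwd)
  ... | no _    = refl

  partner-≤ : ∀ {j} → j ≤ m → partner j ≤ m
  partner-≤ {j} j≤m with forward? j
  ... | yes _ = next-≤ j≤m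
  ... | no _  = prev-≤ j≤m

  partner-≢ : ∀ {j} → j ≤ m → j ≢ i → partner j ≢ i
  partner-≢ {j} j≤m j≢i with forward? j
  ... | yes fwd  = proj₁ (forward-next j≤m fwd)
  ... | no ¬fwd  = proj₁ (backward-prev j≤m j≢i ¬fwd)

  partner-involutive : ∀ {j} → j ≤ m → j ≢ i → partner (partner j) ≡ j
  partner-involutive {j} j≤m j≢i with forward? j
  ... | yes fwd = trans (partner-backward (proj₂ (forward-next j≤m fwd))) (prev-next j≤m)
  ... | no ¬fwd = trans (partner-forward (proj₂ (backward-prev j≤m j≢i ¬fwd))) (next-prev j≤m)

  partner-adjacent : ∀ {j} → j ≤ m → CyclicallyAdjacent j (partner j)
  partner-adjacent {j} j≤m with forward? j
  ... | yes _ = inj₁ refl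
  ... | no _  = inj₂ (next-prev j≤m)

  partner-≢-self : 0 < m → ∀ j → partner j ≢ j
  partner-≢-self 0<m j with forward? j
  ... | yes _ = next-≢ 0<m j
  ... | no _  = prev-≢ 0<m j

oddCycle-matching : ∀ {m} → parity m ≡ 0ℙ → 0 < m → (i : Fin (suc m)) →
  Σ (Fin (suc m) → Fin (suc m)) λ π → ∀ j → j ≢ i →
    π j ≢ i × π (π j) ≡ j × π j ≢ j × CyclicOrder.CyclicallyAdjacent m (toℕ j) (toℕ (π j))
oddCycle-matching {m} m-even 0<m i = π , λ j j≢i → let j≢i′ = j≢i ∘ toℕ-injective in
  (λ πj≡i → partner-≢ (toℕ≤m j) j≢i′ (trans (sym (toℕ-π j)) (cong toℕ πj≡i))) ,
  toℕ-injective (trans (toℕ-π (π j)) (trans (cong partner (toℕ-π j)) (partner-involutive (toℕ≤m j) j≢i′))) ,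
  (λ πj≡j → partner-≢-self 0<m (toℕ j) (trans (sym (toℕ-π j)) (cong toℕ πj≡j))) ,
  subst (CyclicallyAdjacent (toℕ j)) (sym (toℕ-π j)) (partner-adjacent (toℕ≤m j))
  where
  open CyclicOrder m
  open OddCycleMatching m m-even (toℕ i) (toℕ≤pred[n] i)
  toℕ≤m : ∀ (j : Fin (suc m)) → toℕ j ≤ m
  toℕ≤m = toℕ≤pred[n]
  π : Fin (suc m) → Fin (suc m)
  π j = fromℕ< (s≤s (partner-≤ (toℕ≤m j)))
  toℕ-π : ∀ j → toℕ (π j) ≡ partner (toℕ j)
  toℕ-π j = toℕ-fromℕ< (s≤s (partner-≤ (toℕ≤m j)))

hamiltonCycle-edge : ∀ {n m} (G : Graph n) → IsSimple G → (f : Fin (suc m) → Fin n) →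
  (∀ (k : Fin m) → G (f (inject₁ k)) (f (Fin.suc k)) ≡ true) → G (f (fromℕ m)) (f Fin.zero) ≡ true →
  ∀ j k → CyclicOrder.CyclicallyAdjacent m (toℕ j) (toℕ k) → G (f j) (f k) ≡ true
hamiltonCycle-edge {n} {m} G G-simple f step close j k (inj₁ next-j≡k) = next-edge j k next-j≡k
  where
  open CyclicOrder m
  next-edge : ∀ j k → next (toℕ j) ≡ toℕ k → G (f j) (f k) ≡ true
  next-edge j k next-j≡k with toℕ j ℕ.≟ m
  ... | yes j≡m = subst₂ (λ a b → G (f a) (f b) ≡ true)
                    (toℕ-injective (trans (toℕ-fromℕ m) (sym j≡m))) (toℕ-injective next-j≡k) close
  ... | no j≢m  = subst₂ (λ a b → G (f a) (f b) ≡ true)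
                    (toℕ-injective (trans (toℕ-inject₁ j′) (toℕ-fromℕ< j<m)))
                    (toℕ-injective (trans (cong suc (toℕ-fromℕ< j<m)) next-j≡k)) (step j′)
    where
    j<m : toℕ j < m
    j<m = ≤∧≢⇒< (toℕ≤pred[n] j) j≢m
    j′ : Fin m
    j′ = fromℕ< j<m
hamiltonCycle-edge G G-simple f step close j k (inj₂ next-k≡j) =
  edge-sym G-simple (hamiltonCycle-edge G G-simple f step close k j (inj₁ next-k≡j))

-- An odd cycle together with three more vertices

triple : ∀ {A : Set} → A → A → A → Fin 3 → A
triple b c d 0F = b
triple b c d 1F = c
triple b c d 2F = d

[,]-injective : ∀ {A B C : Set} {f : A → C} {g : B → C} → Injective _≡_ _≡_ f → Injective _≡_ _≡_ g →
  (∀ a b → f a ≢ g b) → Injective _≡_ _≡_ [ f , g ]′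
[,]-injective f-inj g-inj disjoint {inj₁ a} {inj₁ a′} fa≡fa′ = cong inj₁ (f-inj fa≡fa′)
[,]-injective f-inj g-inj disjoint {inj₁ a} {inj₂ b}  fa≡gb  = ⊥-elim (disjoint a b fa≡gb)
[,]-injective f-inj g-inj disjoint {inj₂ b} {inj₁ a}  gb≡fa  = ⊥-elim (disjoint a b (sym gb≡fa))
[,]-injective f-inj g-inj disjoint {inj₂ b} {inj₂ b′} gb≡gb′ = cong inj₂ (g-inj gb≡gb′)

triple-injective : ∀ {A : Set} {b c d : A} → b ≢ c → b ≢ d → c ≢ d → Injective _≡_ _≡_ (triple b c d)
triple-injective b≢c b≢d c≢d {0F} {0F} _ = refl
triple-injective b≢c b≢d c≢d {0F} {1F} b≡c = ⊥-elim (b≢c b≡c)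
triple-injective b≢c b≢d c≢d {0F} {2F} b≡d = ⊥-elim (b≢d b≡d)
triple-injective b≢c b≢d c≢d {1F} {0F} c≡b = ⊥-elim (b≢c (sym c≡b))
triple-injective b≢c b≢d c≢d {1F} {1F} _ = refl
triple-injective b≢c b≢d c≢d {1F} {2F} c≡d = ⊥-elim (c≢d c≡d)
triple-injective b≢c b≢d c≢d {2F} {0F} d≡b = ⊥-elim (b≢d (sym d≡b))
triple-injective b≢c b≢d c≢d {2F} {1F} d≡c = ⊥-elim (c≢d (sym d≡c))
triple-injective b≢c b≢d c≢d {2F} {2F} _ = refl

bijection-⊎⇒+ : ∀ {k l n} (label : Fin k ⊎ Fin l → Fin n) →
  Injective _≡_ _≡_ label → Surjective _≡_ _≡_ label → k + l ≡ n
bijection-⊎⇒+ {k} {l} label label-injective label-surjective =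
  cantor-schröder-bernstein {f = label ∘ splitAt k} {g = join k l ∘ index}
    (splitAt-injective ∘ label-injective) (index-injective ∘ join-injective)
  where
  index : Fin _ → Fin k ⊎ Fin l
  index v = proj₁ (label-surjective v)
  index-injective : Injective _≡_ _≡_ index
  index-injective {v} {v′} eq =
    trans (sym (proj₂ (label-surjective v) refl)) (trans (cong label eq) (proj₂ (label-surjective v′) refl))
  splitAt-injective : Injective _≡_ _≡_ (splitAt k {l})
  splitAt-injective {a} {a′} eq =
    trans (sym (join-splitAt k l a)) (trans (cong (join k l) eq) (join-splitAt k l a′))
  join-injective : Injective _≡_ _≡_ (join k l)
  join-injective {a} {a′} eq =
    trans (sym (splitAt-join k l a)) (trans (cong (splitAt k) eq) (splitAt-join k l a′))

record Outsiders {n m} (f : Fin (suc m) → Fin n) (b c d : Fin n) : Set where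
  field
    b≢c : b ≢ c
    b≢d : b ≢ d
    c≢d : c ≢ d
    avoids : ∀ j → (f j ≢ b) × (f j ≢ c) × (f j ≢ d)
    covers : ∀ v → v ≢ b → v ≢ c → v ≢ d → ∃ λ j → f j ≡ v

  label-injective : Injective _≡_ _≡_ f → Injective _≡_ _≡_ [ f , triple b c d ]′
  label-injective f-injective = [,]-injective f-injective (triple-injective b≢c b≢d c≢d) disjoint
    where
    disjoint : ∀ j t → f j ≢ triple b c d t
    disjoint j 0F = proj₁ (avoids j)
    disjoint j 1F = proj₁ (proj₂ (avoids j))
    disjoint j 2F = proj₂ (proj₂ (avoids j))

  label-surjective : Surjective _≡_ _≡_ [ f , triple b c d ]′
  label-surjective v with v ≟ b | v ≟ c | v ≟ d
  ... | yes v≡b | _       | _       = inj₂ 0F , λ { refl → sym v≡b }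
  ... | no _    | yes v≡c | _       = inj₂ 1F , λ { refl → sym v≡c }
  ... | no _    | no _    | yes v≡d = inj₂ 2F , λ { refl → sym v≡d }
  ... | no v≢b  | no v≢c  | no v≢d  =
    inj₁ (proj₁ (covers v v≢b v≢c v≢d)) , λ { refl → proj₂ (covers v v≢b v≢c v≢d) }

Outsiders-swap₁₂ : ∀ {n m} {f : Fin (suc m) → Fin n} {b c d} → Outsiders f b c d → Outsiders f c b d
Outsiders-swap₁₂ o = record
  { b≢c = b≢c ∘ sym ; b≢d = c≢d ; c≢d = b≢d
  ; avoids = λ j → let (≢b , ≢c , ≢d) = avoids j in ≢c , ≢b , ≢d
  ; covers = λ v v≢c v≢b v≢d → covers v v≢b v≢c v≢d }
  where open Outsiders o

Outsiders-swap₂₃ : ∀ {n m} {f : Fin (suc m) → Fin n} {b c d} → Outsiders f b c d → Outsiders f b d c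
Outsiders-swap₂₃ o = record
  { b≢c = b≢d ; b≢d = b≢c ; c≢d = c≢d ∘ sym
  ; avoids = λ j → let (≢b , ≢c , ≢d) = avoids j in ≢b , ≢d , ≢c
  ; covers = λ v v≢b v≢d v≢c → covers v v≢b v≢c v≢d }
  where open Outsiders o

oddCycle-plus-three⇒HasPM : ∀ {n m} (G : Graph n) → IsSimple G →
  (f : Fin (suc m) → Fin n) → Injective _≡_ _≡_ f →
  (∀ (k : Fin m) → G (f (inject₁ k)) (f (Fin.suc k)) ≡ true) → G (f (fromℕ m)) (f Fin.zero) ≡ true →
  parity m ≡ 0ℙ → 0 < m → ∀ {b c d} → Outsiders f b c d →
  ∀ i → G (f i) b ≡ true → G c d ≡ true → HasPM G
oddCycle-plus-three⇒HasPM {m = m} G G-simple f f-injective step close m-even 0<m {b} {c} {d} outsiders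
                          i ib cd =
  perfectMatching-transport G [ f , triple b c d ]′
    (Outsiders.label-injective outsiders f-injective) (Outsiders.label-surjective outsiders)
    μ μ-involutive μ-fixpoint-free μ-edge
  where
  open Σ (oddCycle-matching m-even 0<m i) renaming (proj₁ to π; proj₂ to π-spec)
  μ : Fin (suc m) ⊎ Fin 3 → Fin (suc m) ⊎ Fin 3
  μ (inj₁ j) with j ≟ i
  ... | yes _ = inj₂ 0F
  ... | no _  = inj₁ (π j)
  μ (inj₂ 0F) = inj₁ i
  μ (inj₂ 1F) = inj₂ 2F
  μ (inj₂ 2F) = inj₂ 1F
  μ-off-i : ∀ {j} → j ≢ i → μ (inj₁ j) ≡ inj₁ (π j)
  μ-off-i {j} j≢i with j ≟ i
  ... | yes j≡i = ⊥-elim (j≢i j≡i)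
  ... | no _    = refl
  μ-involutive : ∀ a → μ (μ a) ≡ a
  μ-involutive (inj₁ j) with j ≟ i
  ... | yes refl = refl
  ... | no j≢i   = trans (μ-off-i (proj₁ (π-spec j j≢i))) (cong inj₁ (proj₁ (proj₂ (π-spec j j≢i))))
  μ-involutive (inj₂ 0F) with i ≟ i
  ... | yes _   = refl
  ... | no i≢i  = ⊥-elim (i≢i refl)
  μ-involutive (inj₂ 1F) = refl
  μ-involutive (inj₂ 2F) = refl
  μ-fixpoint-free : ∀ a → μ a ≢ a
  μ-fixpoint-free (inj₁ j) with j ≟ i
  ... | yes _  = λ ()
  ... | no j≢i = proj₁ (proj₂ (proj₂ (π-spec j j≢i))) ∘ inj₁-injective
  μ-fixpoint-free (inj₂ 0F) ()
  μ-fixpoint-free (inj₂ 1F) ()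
  μ-fixpoint-free (inj₂ 2F) ()
  μ-edge : ∀ a → G ([ f , triple b c d ]′ a) ([ f , triple b c d ]′ (μ a)) ≡ true
  μ-edge (inj₁ j) with j ≟ i
  ... | yes refl = ib
  ... | no j≢i   = hamiltonCycle-edge G G-simple f step close j (π j) (proj₂ (proj₂ (proj₂ (π-spec j j≢i))))
  μ-edge (inj₂ 0F) = edge-sym G-simple ib
  μ-edge (inj₂ 1F) = cd
  μ-edge (inj₂ 2F) = edge-sym G-simple cd

-- The game started from G₀

module SaturationGame {n} (G₀ : Graph n) (G₀-simple : IsSimple G₀) (G₀-noPM : ¬ HasPM G₀)
  (w x y z : Fin n) (w≢x : w ≢ x) (w≢y : w ≢ y) (w≢z : w ≢ z)
  (wx : G₀ w x ≡ true) (y-isolated : ∀ t → G₀ y t ≡ false) (z-isolated : ∀ t → G₀ z t ≡ false)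
  {m} (f : Fin (suc m) → Fin n) (f-injective : Injective _≡_ _≡_ f) (xyz : Outsiders f x y z)
  (step : ∀ (k : Fin m) → G₀ (f (inject₁ k)) (f (Fin.suc k)) ≡ true)
  (close : G₀ (f (fromℕ m)) (f Fin.zero) ≡ true)
  (0<m : 0 < m) (n-even : 2 ∣ n) where

  open Outsiders xyz using () renaming (b≢c to x≢y; b≢d to x≢z; c≢d to y≢z)

  vertex-count : suc m + 3 ≡ n
  vertex-count = bijection-⊎⇒+ _ (Outsiders.label-injective xyz f-injective) (Outsiders.label-surjective xyz)

  m-even : parity m ≡ 0ℙ
  m-even = trans (cong parity (trans (+-comm 4 m) (trans (+-suc m 3) vertex-count))) (parity-even n-even)

  Position : Graph n → Set
  Position G = IsSimple G × ¬ HasPM G × (∀ {a b} → G₀ a b ≡ true → G a b ≡ true)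

  position₀ : Position G₀
  position₀ = G₀-simple , G₀-noPM , id

  position-step : ∀ {G u v} → Position G → LegalMove G u v → Position (addEdge G u v)
  position-step {G} {u} {v} (G-simple , _ , G₀⊆G) (u≢v , _ , noPM) =
    addEdge-simple u≢v G-simple , noPM , addEdge-keeps G u v ∘ G₀⊆G

  data Split : Fin n → Fin n → Set where
    yz : Split y z
    zy : Split z y

  split-swap : ∀ {Y Z} → Split Y Z → Split Z Y
  split-swap yz = zy
  split-swap zy = yz

  split-≢ : ∀ {Y Z} → Split Y Z → Y ≢ Z
  split-≢ yz = y≢z
  split-≢ zy = y≢z ∘ sym

  x≢split : ∀ {Y Z} → Split Y Z → x ≢ Y × x ≢ Z
  x≢split yz = x≢y , x≢z
  x≢split zy = x≢z , x≢y

  outsiders-xYZ : ∀ {Y Z} → Split Y Z → Outsiders f x Y Z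
  outsiders-xYZ yz = xyz
  outsiders-xYZ zy = Outsiders-swap₂₃ xyz

  outsiders-ZxY : ∀ {Y Z} → Split Y Z → Outsiders f Z x Y
  outsiders-ZxY yz = Outsiders-swap₁₂ (Outsiders-swap₂₃ xyz)
  outsiders-ZxY zy = Outsiders-swap₁₂ xyz

  cycle-PM : ∀ {G b c d} → Outsiders f b c d → Position G → ∀ i → G (f i) b ≡ true → G c d ≡ true → HasPM G
  cycle-PM {G} o (G-simple , _ , G₀⊆G) =
    oddCycle-plus-three⇒HasPM G G-simple f f-injective (G₀⊆G ∘ step) (G₀⊆G close) m-even 0<m o

  w-index : Fin (suc m)
  w-index = proj₁ (Outsiders.covers xyz w w≢x w≢y w≢z)

  w-edge : ∀ {G} → Position G → G (f w-index) x ≡ true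
  w-edge {G} (_ , _ , G₀⊆G) =
    subst (λ v → G v x ≡ true) (sym (proj₂ (Outsiders.covers xyz w w≢x w≢y w≢z))) (G₀⊆G wx)

  split-edge⇒HasPM : ∀ {G Y Z} → Split Y Z → Position G → G Y Z ≡ true → HasPM G
  split-edge⇒HasPM split position = cycle-PM (outsiders-xYZ split) position w-index (w-edge position)

  sole-neighbour : ∀ {G Y Z} → Split Y Z → Position G → G x Y ≡ true → ∀ t → G Z t ≡ true → t ≡ x
  sole-neighbour {G} {Y} {Z} split position@(G-simple , noPM , _) xY t Zt with t ≟ x
  ... | yes t≡x = t≡x
  ... | no t≢x with t ≟ Z
  ...   | yes refl with () ← trans (sym Zt) (proj₂ G-simple t)
  ...   | no t≢Z with t ≟ Y
  ...     | yes refl = ⊥-elim (noPM (split-edge⇒HasPM split position (edge-sym G-simple Zt)))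
  ...     | no t≢Y with Outsiders.covers (outsiders-ZxY split) t t≢Z t≢x t≢Y
  ...       | j , refl = ⊥-elim (noPM (cycle-PM (outsiders-ZxY split) position j (edge-sym G-simple Zt) xY))

  -- Either Z is isolated, or Y and Z both have x as their only neighbour; in both cases no edge
  -- avoiding Y and Z creates a perfect matching.
  noPM-away-from-split : ∀ {G Y Z u v} → Split Y Z → Position G → G x Y ≡ true →
    u ≢ Y → u ≢ Z → v ≢ Y → v ≢ Z → ¬ HasPM (addEdge G u v)
  noPM-away-from-split {G} {Y} {Z} {u} {v} split position xY u≢Y u≢Z v≢Y v≢Z with G Z x in Zx
  ... | false = isolated⇒¬HasPM (addEdge G u v) (isolated-addEdge G (u≢Z ∘ sym) (v≢Z ∘ sym) Z-isolated)
    where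
    Z-isolated : ∀ t → G Z t ≡ false
    Z-isolated t with G Z t in Zt
    ... | false = refl
    ... | true with () ← trans (sym (subst (λ a → G Z a ≡ true) (sole-neighbour split position xY t Zt) Zt))
                               Zx
  ... | true = sole-common-neighbour⇒¬HasPM (addEdge G u v) (split-≢ split)
    (sole-neighbour-addEdge G (u≢Y ∘ sym) (v≢Y ∘ sym)
       (sole-neighbour (split-swap split) position (edge-sym (proj₁ position) Zx)))
    (sole-neighbour-addEdge G (u≢Z ∘ sym) (v≢Z ∘ sym) (sole-neighbour split position xY))

  terminal-clique : ∀ {G Y Z} → Split Y Z → Position G → G x Y ≡ true → Terminal G →
    ∀ u v → u ≢ v → u ≢ Y → u ≢ Z → v ≢ Y → v ≢ Z → G u v ≡ true
  terminal-clique {G} split position xY terminal u v u≢v u≢Y u≢Z v≢Y v≢Z with G u v in uv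
  ... | true  = refl
  ... | false = ⊥-elim (terminal u v (u≢v , uv , noPM-away-from-split split position xY u≢Y u≢Z v≢Y v≢Z))

  score-bound-once-xY : ∀ k {G Y Z p s} → Split Y Z → Position G → G x Y ≡ true →
    ScoreF k G p s → (n ∸ 2) C 2 ≤ s
  score-bound-once-xY k {Y = Y} split position xY score
    with ScoreF-attained k (λ H → Position H × H x Y ≡ true)
           (λ { {H} {u} {v} (pos , xY) legal → position-step pos legal , addEdge-keeps H u v xY })
           (position , xY) score
  ... | H , (H-position , H-xY) , terminal , refl =
    clique-avoiding-two⇒numEdges H (split-≢ split) (terminal-clique split H-position H-xY terminal)

  max-reply : ∀ k {G Y Z s} → Split Y Z → Position G → (∀ t → G Z t ≡ false) →
    nonEdges G ≤ k → ScoreF k G Max s → (n ∸ 2) C 2 ≤ s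
  max-reply k {G} {Y} split position Z-isolated bound score with G x Y in xY
  ... | true  = score-bound-once-xY k split position xY score
  ... | false = reply k bound score
    where
    x≢Y : x ≢ Y
    x≢Y = proj₁ (x≢split split)
    legal : LegalMove G x Y
    legal = x≢Y , xY , isolated⇒¬HasPM (addEdge G x Y)
              (isolated-addEdge G (proj₂ (x≢split split) ∘ sym) (split-≢ split ∘ sym) Z-isolated)
    reply : ∀ k {s} → nonEdges G ≤ k → ScoreF k G Max s → (n ∸ 2) C 2 ≤ s
    reply zero    _     (terminal , _) = ⊥-elim (terminal x Y legal)
    reply (suc k) bound score =
      ≤-trans (score-bound-once-xY k split (position-step position legal) (addEdge-adds G x Y)
                 (value-isScore k _ Mini (legalMove-nonEdges legal bound)))
              (ScoreF-Better-move k legal bound score)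

  yz-not-joined : ∀ {u v} → LegalMove G₀ u v → addEdge G₀ u v y z ≢ true
  yz-not-joined {u} {v} legal yz-edge = proj₁ (proj₂ position₁) (split-edge⇒HasPM yz position₁ yz-edge)
    where
    position₁ : Position (addEdge G₀ u v)
    position₁ = position-step position₀ legal

  first-move-isolates : ∀ {u v} → LegalMove G₀ u v →
    ∃ λ Y → ∃ λ Z → Split Y Z × (∀ t → addEdge G₀ u v Z t ≡ false)
  first-move-isolates {u} {v} legal with z ≟ u | z ≟ v | y ≟ u | y ≟ v
  ... | no z≢u   | no z≢v   | _        | _        = y , z , yz , isolated-addEdge G₀ z≢u z≢v z-isolated
  ... | _        | _        | no y≢u   | no y≢v   = z , y , zy , isolated-addEdge G₀ y≢u y≢v y-isolated
  ... | yes refl | _        | yes y≡z  | _        = ⊥-elim (y≢z y≡z)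
  ... | _        | yes refl | _        | yes y≡z  = ⊥-elim (y≢z y≡z)
  ... | yes refl | _        | _        | yes refl =
    ⊥-elim (yz-not-joined legal (edge-sym (addEdge-simple (proj₁ legal) G₀-simple) (addEdge-adds G₀ z y)))
  ... | _        | yes refl | yes refl | _        = ⊥-elim (yz-not-joined legal (addEdge-adds G₀ y z))

  xy-legal : LegalMove G₀ x y
  xy-legal = x≢y , trans (proj₁ G₀-simple x y) (y-isolated x) ,
             isolated⇒¬HasPM (addEdge G₀ x y) (isolated-addEdge G₀ (x≢z ∘ sym) (y≢z ∘ sym) z-isolated)

  game-bound : ∀ k {s} → nonEdges G₀ ≤ k → ScoreF k G₀ Mini s → (n ∸ 2) C 2 ≤ s
  game-bound zero    _ (terminal , _)        = ⊥-elim (terminal x y xy-legal)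
  game-bound (suc k) _ (inj₁ (terminal , _)) = ⊥-elim (terminal x y xy-legal)
  game-bound (suc k) bound (inj₂ (u , v , legal , score , _)) with first-move-isolates legal
  ... | Y , Z , split , Z-isolated =
    max-reply k split (position-step position₀ legal) Z-isolated (legalMove-nonEdges legal bound) score

lemma4p3 : (n : ℕ) → 6 ≤ n → 2 ∣ n →
    (G₀ : Graph n) → IsSimple G₀ → ¬ HasPM G₀ →
    (w x y z : Fin n) →
    w ≢ x → w ≢ y → w ≢ z → x ≢ y → x ≢ z → y ≢ z →
    G₀ w x ≡ true → deg G₀ x ≡ 1 → deg G₀ y ≡ 0 → deg G₀ z ≡ 0 →
    HamiltonCycleOn G₀ (λ v → (v ≢ x) × (v ≢ y) × (v ≢ z)) →
    (s : ℕ) → Score G₀ Mini s → (n ∸ 2) C 2 ≤ s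
lemma4p3 n _ n-even G₀ G₀-simple G₀-noPM w x y z w≢x w≢y w≢z x≢y x≢z y≢z wx _ deg-y deg-z
         (m , f , 2≤m , f-injective , avoids , covers , step , close) s score =
  SaturationGame.game-bound G₀ G₀-simple G₀-noPM w x y z w≢x w≢y w≢z wx
    (deg≡0⇒isolated G₀ deg-y) (deg≡0⇒isolated G₀ deg-z) f f-injective outsiders step close
    (≤-trans (s≤s z≤n) 2≤m) n-even (n * n) (nonEdges≤n*n G₀) score
  where
  outsiders : Outsiders f x y z
  outsiders = record
    { b≢c = x≢y ; b≢d = x≢z ; c≢d = y≢z ; avoids = avoids
    ; covers = λ v v≢x v≢y v≢z → covers v (v≢x , v≢y , v≢z) }
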